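{- Let $n\ge1$, let $C$ be the cyclic shift on $\mathbb{Z}_2^{2n}$, $C(x_0,\dots,x_{2n-1})=(x_1,\dots,x_{2n-1},x_0)$, and for $Y\in\mathbb{Z}_2^{2n}$ let $Y_C=\{C^iY:0\le i\le 2n-1\}$ be its orbit. Let $F(\mathbb{Z}_2^{2n})$ denote the set of $Z\in\mathbb{Z}_2^{2n}$ with $|Z_C|=2n$. If $Y\in F(\mathbb{Z}_2^{2n})$, then the set $Y_CY_C\setminus\{\mathbf{1}\}$, where $Y_CY_C=\{uv:u,v\in Y_C\}$ and $\mathbf{1}=(+1,\dots,+1)$, is not contained in $F(\mathbb{Z}_2^{2n})$.
   Context: $\mathbb{Z}_2^{2n}$ is the group of $\pm1$ sequences of length $2n$ under coordinatewise multiplication. -}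

module Defs where

open import Data.Nat using (ℕ; zero; suc; _*_)
open import Data.Sign using (Sign) renaming (_*_ to _·_)
import Data.Sign.Properties as SignP
open import Data.Vec using (Vec; []; _∷_; _∷ʳ_; zipWith; replicate)
open import Data.Vec.Properties using (≡-dec)
open import Data.List using (List; length; deduplicate; map; upTo)
open import Data.List.Membership.Propositional using (_∈_)
open import Relation.Binary.PropositionalEquality using (_≡_)
open import Relation.Binary.Definitions using (DecidableEquality)

-- ℤ₂^m : ±1 sequences of length m (Sign = {+,-} with multiplication).
Z2 : ℕ → Set
Z2 m = Vec Sign m

_⊙_ : ∀ {m} → Z2 m → Z2 m → Z2 m
_⊙_ = zipWith _·_

𝟏 : ∀ {m} → Z2 m
𝟏 = replicate _ Sign.+

_≟Z_ : ∀ {m} → DecidableEquality (Z2 m)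
_≟Z_ = ≡-dec SignP._≟_

C : ∀ {m} → Z2 m → Z2 m
C [] = []
C (x ∷ xs) = xs ∷ʳ x

C^ : ∀ {m} → ℕ → Z2 m → Z2 m
C^ zero y = y
C^ (suc i) y = C (C^ i y)

-- Y_C = {C^i Y : 0 ≤ i ≤ 2n-1}, as a list (possibly with repetitions)
orbitList : ∀ n → Z2 (2 * n) → List (Z2 (2 * n))
orbitList n y = map (λ i → C^ i y) (upTo (2 * n))

InOrb : ∀ n → Z2 (2 * n) → Z2 (2 * n) → Set
InOrb n u y = u ∈ orbitList n y

orbitCard : ∀ n → Z2 (2 * n) → ℕ
orbitCard n y = length (deduplicate _≟Z_ (orbitList n y))

InF : ∀ n → Z2 (2 * n) → Set
InF n z = orbitCard n z ≡ 2 * n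

module Submission where

-- Put Z = Y ⊙ Cⁿ Y. Since C²ⁿ is the identity and C is a homomorphism for ⊙,
-- Cⁿ Z = Cⁿ Y ⊙ Y = Z, so the orbit of Z has at most n elements and Z ∉ F.
-- Both Y and Cⁿ Y lie in Y_C, so Z ∈ Y_C Y_C; if Z ≠ 𝟏 this contradicts the
-- hypothesis, and if Z = 𝟏 then Cⁿ Y = Y (every element is its own inverse),
-- so Y itself is not in F.

open import Defs
open import Data.Nat using (ℕ; _≤_; _*_)
open import Relation.Nullary using (¬_)
open import Relation.Binary.PropositionalEquality using (_≢_)

open import Data.Nat using (zero; suc; _+_; _<_; _<?_; z≤n; s≤s)
open import Data.Nat.Properties
  using (≤-trans; ≤-reflexive; ≤-antisym; <⇒≤; <-≤-trans; ≮⇒≥; n≮n; m<m+n; +-identityʳ)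
open import Data.Sign using () renaming (_*_ to _·_)
import Data.Sign.Properties as Sign
open import Data.Vec using ([]; _∷_; _∷ʳ_; toList)
import Data.Vec.Properties as Vec
open import Data.List using (List; length; deduplicate; filter; map; upTo; _++_; [_])
import Data.List.Properties as List
open import Data.List.Membership.Propositional using (_∈_)
open import Data.List.Membership.Propositional.Properties
  using (∈-map⁺; ∈-map⁻; ∈-upTo⁺; ∈-upTo⁻; ∈-filter⁺; ∈-deduplicate⁻)
open import Data.List.Relation.Binary.Subset.Propositional using (_⊆_)
open import Data.List.Relation.Unary.Any using (here; there)
import Data.List.Relation.Unary.Any as Any
import Data.List.Relation.Unary.All as All
open import Data.List.Relation.Unary.AllPairs using ([]; _∷_)
open import Data.List.Relation.Unary.Unique.Propositional using (Unique)
open import Data.List.Relation.Unary.Unique.DecPropositional.Properties using (deduplicate-!)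
open import Data.Product using (_,_)
open import Relation.Binary.Definitions using (DecidableEquality)
open import Relation.Binary.PropositionalEquality
  using (_≡_; refl; sym; trans; cong; subst; module ≡-Reasoning)
open import Relation.Nullary using (¬?; yes; no)

Unique-⊆⇒length≤ : ∀ {A : Set} → DecidableEquality A → {xs : List A} → Unique xs →
                   (ys : List A) → xs ⊆ ys → length xs ≤ length ys
Unique-⊆⇒length≤ _≟_ [] ys xs⊆ys = z≤n
Unique-⊆⇒length≤ _≟_ {x List.∷ xs} (x∉xs ∷ xs!) ys x∷xs⊆ys =
  ≤-trans (s≤s (Unique-⊆⇒length≤ _≟_ xs! (filter x≢? ys) xs⊆ys-x))
          (List.filter-notAll x≢? ys (Any.map (λ x≡y x≢y → x≢y x≡y) (x∷xs⊆ys (here refl))))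
  where
  x≢? = λ y → ¬? (x ≟ y)
  xs⊆ys-x : xs ⊆ filter x≢? ys
  xs⊆ys-x z∈xs = ∈-filter⁺ x≢? (x∷xs⊆ys (there z∈xs)) (All.lookup x∉xs z∈xs)

rotate : ∀ {A : Set} → ℕ → List A → List A
rotate zero xs = xs
rotate (suc k) List.[] = List.[]
rotate (suc k) (x List.∷ xs) = rotate k (xs ++ [ x ])

rotate-length-++ : ∀ {A : Set} (xs ys : List A) → rotate (length xs) (xs ++ ys) ≡ ys ++ xs
rotate-length-++ List.[] ys = sym (List.++-identityʳ ys)
rotate-length-++ (x List.∷ xs) ys = begin
  rotate (length xs) ((xs ++ ys) ++ [ x ]) ≡⟨ cong (rotate (length xs)) (List.++-assoc xs ys [ x ]) ⟩
  rotate (length xs) (xs ++ ys ++ [ x ])   ≡⟨ rotate-length-++ xs (ys ++ [ x ]) ⟩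
  (ys ++ [ x ]) ++ xs                      ≡⟨ List.++-assoc ys [ x ] xs ⟩
  ys ++ x List.∷ xs                        ∎
  where open ≡-Reasoning

C^-suc : ∀ {m} k (z : Z2 m) → C^ (suc k) z ≡ C^ k (C z)
C^-suc zero z = refl
C^-suc (suc k) z = cong C (C^-suc k z)

C^-+ : ∀ {m} a b (z : Z2 m) → C^ (a + b) z ≡ C^ a (C^ b z)
C^-+ zero b z = refl
C^-+ (suc a) b z = cong C (C^-+ a b z)

toList-C^ : ∀ {m} k (z : Z2 m) → toList (C^ k z) ≡ rotate k (toList z)
toList-C^ zero z = refl
toList-C^ (suc k) [] with C^ (suc k) []
... | [] = refl
toList-C^ (suc k) (x ∷ xs) = begin
  toList (C^ (suc k) (x ∷ xs)) ≡⟨ cong toList (C^-suc k (x ∷ xs)) ⟩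
  toList (C^ k (xs ∷ʳ x))      ≡⟨ toList-C^ k (xs ∷ʳ x) ⟩
  rotate k (toList (xs ∷ʳ x))  ≡⟨ cong (rotate k) (Vec.toList-∷ʳ x xs) ⟩
  rotate k (toList xs ++ [ x ]) ∎
  where open ≡-Reasoning

C^-length : ∀ {m} (z : Z2 m) → C^ m z ≡ z
C^-length {m} z = trans (sym (Vec.cast-is-id refl (C^ m z)))
                        (Vec.toList-injective refl (C^ m z) z toList-C^ᵐ)
  where
  open ≡-Reasoning
  toList-C^ᵐ : toList (C^ m z) ≡ toList z
  toList-C^ᵐ = begin
    toList (C^ m z)                                  ≡⟨ toList-C^ m z ⟩
    rotate m (toList z)                              ≡⟨ cong (λ k → rotate k (toList z)) (sym (Vec.length-toList z)) ⟩
    rotate (length (toList z)) (toList z)            ≡⟨ cong (rotate (length (toList z))) (sym (List.++-identityʳ (toList z))) ⟩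
    rotate (length (toList z)) (toList z ++ List.[]) ≡⟨ rotate-length-++ (toList z) List.[] ⟩
    toList z                                         ∎

⊙-∷ʳ : ∀ {m} (xs ys : Z2 m) x y → (xs ∷ʳ x) ⊙ (ys ∷ʳ y) ≡ (xs ⊙ ys) ∷ʳ (x · y)
⊙-∷ʳ [] [] x y = refl
⊙-∷ʳ (a ∷ xs) (b ∷ ys) x y = cong ((a · b) ∷_) (⊙-∷ʳ xs ys x y)

C-⊙ : ∀ {m} (u v : Z2 m) → C (u ⊙ v) ≡ C u ⊙ C v
C-⊙ [] [] = refl
C-⊙ (x ∷ xs) (y ∷ ys) = sym (⊙-∷ʳ xs ys x y)

C^-⊙ : ∀ {m} k (u v : Z2 m) → C^ k (u ⊙ v) ≡ C^ k u ⊙ C^ k v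
C^-⊙ zero u v = refl
C^-⊙ (suc k) u v = trans (cong C (C^-⊙ k u v)) (C-⊙ (C^ k u) (C^ k v))

⊙-comm : ∀ {m} (u v : Z2 m) → u ⊙ v ≡ v ⊙ u
⊙-comm = Vec.zipWith-comm Sign.*-comm

⊙≡𝟏⇒≡ : ∀ {m} (u v : Z2 m) → u ⊙ v ≡ 𝟏 → v ≡ u
⊙≡𝟏⇒≡ u v u⊙v≡𝟏 = begin
  v             ≡⟨ sym (Vec.zipWith-identityˡ Sign.*-identityˡ v) ⟩
  𝟏 ⊙ v         ≡⟨ cong (_⊙ v) (sym u⊙u≡𝟏) ⟩
  (u ⊙ u) ⊙ v   ≡⟨ Vec.zipWith-assoc Sign.*-assoc u u v ⟩
  u ⊙ (u ⊙ v)   ≡⟨ cong (u ⊙_) u⊙v≡𝟏 ⟩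
  u ⊙ 𝟏         ≡⟨ Vec.zipWith-identityʳ Sign.*-identityʳ u ⟩
  u             ∎
  where
  open ≡-Reasoning
  u⊙u≡𝟏 : u ⊙ u ≡ 𝟏
  u⊙u≡𝟏 = trans (cong (u ⊙_) (sym (Vec.map-id u))) (Vec.zipWith-inverseʳ Sign.s*s≡+ u)

shifts : ∀ {m} → ℕ → Z2 m → List (Z2 m)
shifts p z = map (λ i → C^ i z) (upTo p)

C^∈shifts : ∀ {m} {i p} (z : Z2 m) → i < p → C^ i z ∈ shifts p z
C^∈shifts z i<p = ∈-map⁺ (λ i → C^ i z) (∈-upTo⁺ i<p)

C^∈shifts-period : ∀ {m p} {z : Z2 m} → 1 ≤ p → C^ p z ≡ z → ∀ i → C^ i z ∈ shifts p z
C^∈shifts-period {z = z} 1≤p period zero = C^∈shifts z 1≤p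
C^∈shifts-period {p = p} {z} 1≤p period (suc i)
  with ∈-map⁻ (λ j → C^ j z) (C^∈shifts-period 1≤p period i)
... | j , j∈ , C^iz≡C^jz with suc j <? p
...   | yes 1+j<p = subst (_∈ shifts p z) (sym (cong C C^iz≡C^jz)) (C^∈shifts z 1+j<p)
...   | no  1+j≮p = subst (_∈ shifts p z) (sym C^[1+i]z≡z) (C^∈shifts z 1≤p)
  where
  C^[1+i]z≡z : C^ (suc i) z ≡ z
  C^[1+i]z≡z = trans (cong C C^iz≡C^jz)
                     (trans (cong (λ k → C^ k z) (≤-antisym (∈-upTo⁻ j∈) (≮⇒≥ 1+j≮p))) period)

orbitCard≤period : ∀ n {p} {z : Z2 (2 * n)} → 1 ≤ p → C^ p z ≡ z → orbitCard n z ≤ p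
orbitCard≤period n {p} {z} 1≤p period =
  ≤-trans (Unique-⊆⇒length≤ _≟Z_ (deduplicate-! _≟Z_ (orbitList n z)) (shifts p z) orbit⊆shifts)
          (≤-reflexive (trans (List.length-map _ (upTo p)) (List.length-upTo p)))
  where
  orbit⊆shifts : deduplicate _≟Z_ (orbitList n z) ⊆ shifts p z
  orbit⊆shifts w∈ with ∈-map⁻ (λ i → C^ i z) (∈-deduplicate⁻ _≟Z_ (orbitList n z) w∈)
  ... | i , _ , refl = C^∈shifts-period 1≤p period i

n<2*n : ∀ {n} → 1 ≤ n → n < 2 * n
n<2*n {n} 1≤n = subst (n <_) (cong (n +_) (sym (+-identityʳ n))) (m<m+n n 1≤n)

C^n-periodic⇒∉F : ∀ n {z : Z2 (2 * n)} → 1 ≤ n → C^ n z ≡ z → ¬ InF n z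
C^n-periodic⇒∉F n 1≤n period z∈F =
  n≮n n (<-≤-trans (subst (n <_) (sym z∈F) (n<2*n 1≤n)) (orbitCard≤period n 1≤n period))

C^n-⊙-periodic : ∀ n (y : Z2 (2 * n)) → C^ n (y ⊙ C^ n y) ≡ y ⊙ C^ n y
C^n-⊙-periodic n y = begin
  C^ n (y ⊙ C^ n y)       ≡⟨ C^-⊙ n y (C^ n y) ⟩
  C^ n y ⊙ C^ n (C^ n y)  ≡⟨ cong (C^ n y ⊙_) C^nC^ny≡y ⟩
  C^ n y ⊙ y              ≡⟨ ⊙-comm (C^ n y) y ⟩
  y ⊙ C^ n y              ∎
  where
  open ≡-Reasoning
  C^nC^ny≡y : C^ n (C^ n y) ≡ y
  C^nC^ny≡y = trans (sym (C^-+ n n y))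
                    (trans (cong (λ k → C^ k y) (cong (n +_) (sym (+-identityʳ n)))) (C^-length y))

mainTheorem12 : (n : ℕ) → 1 ≤ n → (Y : Z2 (2 * n)) → InF n Y →
    ¬ ((u v : Z2 (2 * n)) → InOrb n u Y → InOrb n v Y → (u ⊙ v) ≢ 𝟏 → InF n (u ⊙ v))
mainTheorem12 n 1≤n Y Y∈F closed with (Y ⊙ C^ n Y) ≟Z 𝟏
... | yes Y⊙C^nY≡𝟏 = C^n-periodic⇒∉F n 1≤n (⊙≡𝟏⇒≡ Y (C^ n Y) Y⊙C^nY≡𝟏) Y∈F
... | no  Y⊙C^nY≢𝟏 = C^n-periodic⇒∉F n 1≤n (C^n-⊙-periodic n Y)
        (closed Y (C^ n Y) (C^∈shifts Y 0<2n) (C^∈shifts Y (n<2*n 1≤n)) Y⊙C^nY≢𝟏)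
  where
  0<2n : 0 < 2 * n
  0<2n = ≤-trans 1≤n (<⇒≤ (n<2*n 1≤n))
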